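{- LFI3 is a sublogic of classical logic, that is: for every set of formulas $\Gamma$ and formula $\psi$, if $\Gamma \vDash_{LFI3} \psi$ then $\Gamma \vDash_{CPL} \psi$.
   Context: Formulas are built from propositional variables with the connectives $\neg, \circ$ (unary) and $\land, \lor, \rightarrow$ (binary). On $\{0,1\}$ write $\land,\lor,\to$ for Boolean meet, join, implication and ${\sim}$ for Boolean complement. LFI3 is the logic of the 5-element logical matrix whose domain is $\mathbb{B}=\{T,t,b,f,F\}$ with $T=(1,0,0)$, $t=(1,0,1)$, $b=(1,1,1)$, $f=(0,1,1)$, $F=(0,1,0)$, whose designated values are $\{T,t,b\}$ (the triples with first coordinate $1$), and whose operations are, for $a=(a_1,a_2,a_3)$, $c=(c_1,c_2,c_3)$ in $\mathbb{B}$: $a \land c = (a_1\land c_1,\ a_2\lor c_2,\ ({\sim}a_2\land c_3)\lor(a_3\land{\sim}c_2)\lor(a_3\land c_3))$; $a\lor c=(a_1\lor c_1,\ a_2\land c_2,\ ({\sim}a_1\land c_3)\lor(a_3\land{\sim}c_1)\lor(a_3\land c_3))$; $a\to c=(a_1\to c_1,\ c_2\land({\sim}a_2\lor a_3),\ ({\sim}a_2\land c_3)\lor({\sim}a_2\land a_3\land{\sim}c_1)\lor(a_3\land c_3)\lor({\sim}a_1\land a_3\land{\sim}c_1))$; $\neg a=(a_2,a_1,a_3)$; $\circ a=({\sim}(a_1\land a_2),\ a_3,\ a_3\land{\sim}(a_1\land a_2))$. (Equivalently, on the linear order $F<f<b<t<T$, $\land$ is minimum and $\lor$ is maximum.) $\Gamma\vDash_{LFI3}\psi$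 means every valuation into this matrix making all of $\Gamma$ designated makes $\psi$ designated. Classical logic CPL here is the matrix logic of the two-element subalgebra $\{T,F\}$ (which is closed under all operations, with $\circ T=\circ F=T$), with $T$ as the only designated value. -}

module Defs where

open import Data.Nat using (ℕ)
open import Data.Bool using (Bool; true; false; _∧_; _∨_; not)
open import Data.Product using (_×_; _,_; proj₁; proj₂)
open import Relation.Binary.PropositionalEquality using (_≡_)

data Formula : Set where
  var  : ℕ → Formula
  ¬'_  : Formula → Formula
  ∘'_  : Formula → Formula
  _∧'_ : Formula → Formula → Formula
  _∨'_ : Formula → Formula → Formula
  _→'_ : Formula → Formula → Formula

_⇒_ : Bool → Bool → Bool
a ⇒ c = not a ∨ c

Triple : Set
Triple = Bool × Bool × Bool

fst snd thd : Triple → Bool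
fst (a , _ , _) = a
snd (_ , a , _) = a
thd (_ , _ , a) = a

andT : Triple → Triple → Triple
andT (a1 , a2 , a3) (c1 , c2 , c3) =
  (a1 ∧ c1) , (a2 ∨ c2) , ((not a2 ∧ c3) ∨ (a3 ∧ not c2) ∨ (a3 ∧ c3))

orT : Triple → Triple → Triple
orT (a1 , a2 , a3) (c1 , c2 , c3) =
  (a1 ∨ c1) , (a2 ∧ c2) , ((not a1 ∧ c3) ∨ (a3 ∧ not c1) ∨ (a3 ∧ c3))

impT : Triple → Triple → Triple
impT (a1 , a2 , a3) (c1 , c2 , c3) =
  (a1 ⇒ c1) , (c2 ∧ (not a2 ∨ a3)) ,
  ((not a2 ∧ c3) ∨ (not a2 ∧ a3 ∧ not c1) ∨ (a3 ∧ c3) ∨ (not a1 ∧ a3 ∧ not c1))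

negT : Triple → Triple
negT (a1 , a2 , a3) = a2 , a1 , a3

circT : Triple → Triple
circT (a1 , a2 , a3) = not (a1 ∧ a2) , a3 , (a3 ∧ not (a1 ∧ a2))

eval : (ℕ → Triple) → Formula → Triple
eval v (var n)   = v n
eval v (¬' φ)    = negT (eval v φ)
eval v (∘' φ)    = circT (eval v φ)
eval v (φ ∧' ψ)  = andT (eval v φ) (eval v ψ)
eval v (φ ∨' ψ)  = orT (eval v φ) (eval v ψ)
eval v (φ →' ψ)  = impT (eval v φ) (eval v ψ)

data 𝔹 : Set where
  T t b f F : 𝔹

⟦_⟧ : 𝔹 → Triple
⟦ T ⟧ = true , false , false
⟦ t ⟧ = true , false , true
⟦ b ⟧ = true , true , true
⟦ f ⟧ = false , true , true
⟦ F ⟧ = false , true , false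

Designated : Triple → Set
Designated x = fst x ≡ true

FormulaSet : Set₁
FormulaSet = Formula → Set

_⊨LFI3_ : FormulaSet → Formula → Set
Γ ⊨LFI3 ψ = (v : ℕ → 𝔹) →
  (∀ φ → Γ φ → Designated (eval (λ n → ⟦ v n ⟧) φ)) →
  Designated (eval (λ n → ⟦ v n ⟧) ψ)

-- The two-element subalgebra {T, F}
data 𝟚 : Set where
  T₂ F₂ : 𝟚

⟦_⟧₂ : 𝟚 → 𝔹
⟦ T₂ ⟧₂ = T
⟦ F₂ ⟧₂ = F

-- CPL consequence: matrix logic of {T,F} with T the only designated value
-- (among T, F, "first coordinate 1" singles out exactly T)
_⊨CPL_ : FormulaSet → Formula → Set
Γ ⊨CPL ψ = (v : ℕ → 𝟚) →
  (∀ φ → Γ φ → Designated (eval (λ n → ⟦ ⟦ v n ⟧₂ ⟧) φ)) →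
  Designated (eval (λ n → ⟦ ⟦ v n ⟧₂ ⟧) ψ)

{-# OPTIONS --safe #-}
module Submission where

open import Defs

theorem12 : (Γ : FormulaSet) (ψ : Formula) → Γ ⊨LFI3 ψ → Γ ⊨CPL ψ
theorem12 Γ ψ Γ⊨ψ v = Γ⊨ψ (λ n → ⟦ v n ⟧₂)
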